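{- Let $n\ge 4$ be divisible by $4$, let $a=n/2$, and let $1\le r\le n-1$ be odd with $r^2+n/2\equiv 1\pmod n$. Then the rose window graph $R_n(a,r)$ is a Cayley graph.
   Context: For integers $n\ge 3$ and $1\le a,r\le n-1$, the rose window graph $R_n(a,r)$ has vertex set $\{A_i,B_i : i\in\mathbb{Z}_n\}$ and edges $A_iA_{i+1}$, $A_iB_i$, $A_{i+a}B_i$ and $B_iB_{i+r}$, indices taken modulo $n$. A graph is Cayley iff its automorphism group has a subgroup acting regularly on its vertices. -}

module Defs where

open import Level using (Level) renaming (suc to lsuc; zero to lzero)
open import Data.Nat using (ℕ; _+_; _*_)
open import Data.Bool using (Bool; true; false)
open import Data.Fin using (Fin; toℕ)
open import Data.Product using (_×_; _,_; Σ; ∃; ∃-syntax)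
open import Data.Sum using (_⊎_)
open import Relation.Binary.PropositionalEquality using (_≡_)

-- Arithmetic in ℤ_n with elements represented by Fin n:
-- (i +[ k ]≡ j)  ⇔  toℕ i + k ≡ toℕ j (mod n).
_+[_]≡_ : {n : ℕ} → Fin n → ℕ → Fin n → Set
_+[_]≡_ {n} i k j = ∃[ q ] (toℕ i + k ≡ toℕ j + q * n)

RWVertex : ℕ → Set
RWVertex n = Bool × Fin n

A : {n : ℕ} → Fin n → RWVertex n
A i = (false , i)

B : {n : ℕ} → Fin n → RWVertex n
B i = (true , i)

data RWEdge (n a r : ℕ) : RWVertex n → RWVertex n → Set where
  rim   : ∀ {i j : Fin n} → i +[ 1 ]≡ j → RWEdge n a r (A i) (A j)
  hub   : ∀ {i : Fin n} → RWEdge n a r (A i) (B i)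
  spoke : ∀ {i j : Fin n} → i +[ a ]≡ j → RWEdge n a r (A j) (B i)
  inner : ∀ {i j : Fin n} → i +[ r ]≡ j → RWEdge n a r (B i) (B j)

RWAdj : (n a r : ℕ) → RWVertex n → RWVertex n → Set
RWAdj n a r u v = RWEdge n a r u v ⊎ RWEdge n a r v u

record Automorphism (V : Set) (Adj : V → V → Set) : Set where
  field
    fun      : V → V
    inv      : V → V
    inv-left  : ∀ x → inv (fun x) ≡ x
    inv-right : ∀ x → fun (inv x) ≡ x
    preserves : ∀ x y → Adj x y → Adj (fun x) (fun y)
    reflects  : ∀ x y → Adj (fun x) (fun y) → Adj x y
open Automorphism public

-- A subgroup of Aut(Γ), given as a predicate on automorphisms, closed under
-- identity, composition and inverses (automorphisms are compared pointwise,
-- and membership is required to respect pointwise equality).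
record IsAutSubgroup (V : Set) (Adj : V → V → Set)
       (H : Automorphism V Adj → Set) : Set where
  field
    resp  : ∀ g h → (∀ x → fun g x ≡ fun h x) → H g → H h
    hasId : ∀ g → (∀ x → fun g x ≡ x) → H g
    comp  : ∀ g h → H g → H h → ∀ k → (∀ x → fun k x ≡ fun g (fun h x)) → H k
    inverse : ∀ g → H g → ∀ k → (∀ x → fun k x ≡ inv g x) → H k

-- H acts regularly on V: for all u v there is exactly one h ∈ H
-- (up to equality as permutations) with h u = v.
record IsRegular (V : Set) (Adj : V → V → Set)
       (H : Automorphism V Adj → Set) : Set where
  field
    transitive : ∀ u v → ∃[ h ] (H h × fun h u ≡ v)
    semiregular : ∀ g h u → H g → H h → fun g u ≡ fun h u → ∀ x → fun g x ≡ fun h x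

-- Γ is a Cayley graph iff Aut(Γ) has a subgroup acting regularly on V(Γ).
IsCayley : (V : Set) (Adj : V → V → Set) → Set₁
IsCayley V Adj = ∃[ H ] (IsAutSubgroup V Adj H × IsRegular V Adj H)

module Submission where

-- Write n = 8D and a = 4D (r² ≡ 1 modulo 8, so the congruence r² + a ≡ 1 (mod n)
-- forces 8 ∣ n), and let c be whichever of ±r is 3 modulo 4.  With A_x, B_x indexed
-- by integers read modulo n, three automorphisms of R_n(a,r) are
--   glide k : A_x ↦ A_{x+2k}, B_x ↦ B_{x+(2+a)k}   (hubs and spokes trade places when k is odd),
--   reflect : A_x ↦ A_{1-x},  B_x ↦ B_{1-x},
--   swap    : A_x ↦ B_{cx},   B_x ↦ A_{(c+a)x}      (an involution, as c(c+a) ≡ c² + a ≡ 1).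
-- They satisfy reflect∘glide k∘reflect = glide (-k), swap∘glide k∘swap = glide ((c+2D)k)
-- and swap∘reflect∘swap = glide w∘reflect with w = (c-1)/2 + 2D, which needs w odd, i.e.
-- c ≡ 3 (mod 4).  Hence the products glide k∘reflect^e∘swap^s form a group H of
-- automorphisms.  H is transitive, and an element of H fixing A_0 is trivial: swap
-- changes the rim, a reflected glide moves every A_x by an odd amount, and a glide
-- fixing A_0 has 2k ≡ 0 and is then the identity.  So H acts regularly, and R_n(a,r)
-- is a Cayley graph by Sabidussi's theorem.

open import Defs
open import Data.Nat using (ℕ; _+_; _*_; _≤_; _<_)
open import Data.Nat.Divisibility using (_∣_)
open import Data.Product using (_×_; ∃-syntax)
open import Relation.Binary.PropositionalEquality using (_≡_)
open import Relation.Nullary using (¬_)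

open import Data.Nat as ℕ using (NonZero; s≤s)
import Data.Nat.Properties as ℕ
import Data.Nat.DivMod as ℕ
import Data.Nat.Divisibility as ℕ
open import Data.Nat.Divisibility using (divides; ∣m+n∣m⇒∣n; quotient)
open Data.Nat.Divisibility._∣_ using (equality)
import Data.Nat.Tactic.RingSolver as ℕ-Solver
open import Data.Integer using (ℤ; +_; 0ℤ; 1ℤ; _⊖_; ∣_∣)
  renaming (_+_ to _+ᶻ_; _*_ to _*ᶻ_; _-_ to _-ᶻ_; -_ to -ᶻ_)
import Data.Integer.Properties as ℤ
open import Data.Integer.DivMod using (_%ℕ_; _/ℕ_; n%ℕd<d; a≡a%ℕn+[a/ℕn]*n)
import Data.Integer.Divisibility.Signed as Signed
open import Data.Integer.Tactic.RingSolver using (solve-∀)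
open import Data.Bool using (Bool; true; false; _xor_)
open import Data.Bool.Properties using (xor-same)
open import Data.Fin using (Fin; toℕ; fromℕ<)
import Data.Fin.Properties as Fin
open import Data.Product using (_,_; proj₁; proj₂)
open import Data.Sum using (_⊎_; inj₁; inj₂; [_,_]′) renaming (map to ⊎-map)
open import Function using (_∘_)
open import Relation.Binary.Bundles using (Setoid)
open import Relation.Binary.Structures using (IsEquivalence)
import Relation.Binary.Reasoning.Setoid
open import Relation.Nullary using (contradiction)
open import Relation.Binary.PropositionalEquality
  using (_≢_; refl; sym; trans; cong; cong₂; subst; subst₂; module ≡-Reasoning)

module _ {V : Set} {Adj : V → V → Set} where

  Preserves : (V → V) → Set
  Preserves f = ∀ x y → Adj x y → Adj (f x) (f y)

  automorphism : (f g : V → V) → (∀ x → g (f x) ≡ x) → (∀ x → f (g x) ≡ x)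
               → Preserves f → Preserves g → Automorphism V Adj
  automorphism f g gf fg pf pg = record
    { fun = f ; inv = g ; inv-left = gf ; inv-right = fg ; preserves = pf
    ; reflects = λ x y adj → subst₂ Adj (gf x) (gf y) (pg (f x) (f y) adj) }

  involution : (f : V → V) → (∀ x → f (f x) ≡ x) → Preserves f → Automorphism V Adj
  involution f ff pf = automorphism f f ff ff pf pf

  idᵃ : Automorphism V Adj
  idᵃ = involution (λ x → x) (λ _ → refl) (λ _ _ adj → adj)

  infixr 9 _∘ᵃ_
  _∘ᵃ_ : Automorphism V Adj → Automorphism V Adj → Automorphism V Adj
  g ∘ᵃ h = record
    { fun = fun g ∘ fun h
    ; inv = inv h ∘ inv g
    ; inv-left = λ x → trans (cong (inv h) (inv-left g (fun h x))) (inv-left h x)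
    ; inv-right = λ x → trans (cong (fun g) (inv-right h (inv g x))) (inv-right g x)
    ; preserves = λ x y → preserves g _ _ ∘ preserves h x y
    ; reflects = λ x y → reflects h x y ∘ reflects g _ _ }

  _^_ : Automorphism V Adj → Bool → Automorphism V Adj
  h ^ false = idᵃ
  h ^ true = h

  ^-xor : ∀ h → (∀ x → fun h (fun h x) ≡ x)
        → ∀ e e′ x → fun (h ^ e) (fun (h ^ e′) x) ≡ fun (h ^ (e xor e′)) x
  ^-xor h hh false e′ x = refl
  ^-xor h hh true false x = refl
  ^-xor h hh true true x = hh x

  regular-family⇒IsCayley :
      (P : Set) (aut : P → Automorphism V Adj) (base : V)
    → (∀ p q → ∃[ r ] (∀ x → fun (aut r) x ≡ fun (aut p) (fun (aut q) x)))
    → (∀ p → ∃[ q ] (∀ x → fun (aut q) (fun (aut p) x) ≡ x))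
    → (∀ v → ∃[ p ] (fun (aut p) base ≡ v))
    → (∀ p → fun (aut p) base ≡ base → ∀ x → fun (aut p) x ≡ x)
    → IsCayley V Adj
  regular-family⇒IsCayley P aut base compose invert reach free =
    H , subgroup , regular
    where
    act : P → V → V
    act p = fun (aut p)

    H : Automorphism V Adj → Set
    H g = ∃[ p ] (∀ x → fun g x ≡ act p x)

    left-inverse-is-right : ∀ p x → act p (act (proj₁ (invert p)) x) ≡ x
    left-inverse-is-right p x = begin
      act p (act q x)                        ≡⟨ sym (inv-left (aut q) _) ⟩
      inv (aut q) (act q (act p (act q x)))  ≡⟨ cong (inv (aut q)) (proj₂ (invert p) (act q x)) ⟩
      inv (aut q) (act q x)                  ≡⟨ inv-left (aut q) x ⟩
      x                                      ∎
      where
      open ≡-Reasoning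
      q : P
      q = proj₁ (invert p)

    fixes-one⇒identity : ∀ c u → act c u ≡ u → ∀ x → act c x ≡ x
    fixes-one⇒identity c u cu≡u x = begin
      act c x                                ≡⟨ cong (act c) (sym (left-inverse-is-right p x)) ⟩
      act c (act p (act w x))                ≡⟨ sym (left-inverse-is-right p _) ⟩
      act p (act w (act c (act p (act w x)))) ≡⟨ cong (act p) (sym (d≡ (act w x))) ⟩
      act p (act d (act w x))                ≡⟨ cong (act p) (free d d-fixes-base (act w x)) ⟩
      act p (act w x)                        ≡⟨ left-inverse-is-right p x ⟩
      x                                      ∎
      where
      open ≡-Reasoning
      p w cp d : P
      p = proj₁ (reach u)
      w = proj₁ (invert p)
      cp = proj₁ (compose c p)
      d = proj₁ (compose w cp)
      d≡ : ∀ z → act d z ≡ act w (act c (act p z))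
      d≡ z = trans (proj₂ (compose w cp) z) (cong (act w) (proj₂ (compose c p) z))
      d-fixes-base : act d base ≡ base
      d-fixes-base = begin
        act d base                   ≡⟨ d≡ base ⟩
        act w (act c (act p base))   ≡⟨ cong (act w ∘ act c) (proj₂ (reach u)) ⟩
        act w (act c u)              ≡⟨ cong (act w) cu≡u ⟩
        act w u                      ≡⟨ cong (act w) (sym (proj₂ (reach u))) ⟩
        act w (act p base)           ≡⟨ proj₂ (invert p) base ⟩
        base                         ∎

    subgroup : IsAutSubgroup V Adj H
    subgroup = record
      { resp = λ { g h g≗h (p , g≗p) → p , λ x → trans (sym (g≗h x)) (g≗p x) }
      ; hasId = λ g g≗id → p₀ , λ x →
          trans (g≗id x) (sym (fixes-one⇒identity p₀ base (proj₂ (reach base)) x))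
      ; comp = λ { g h (p , g≗p) (q , h≗q) k k≗gh →
          proj₁ (compose p q) , λ x → trans (k≗gh x) (trans (g≗p _) (trans (cong (act p) (h≗q x))
                                         (sym (proj₂ (compose p q) x)))) }
      ; inverse = λ { g (p , g≗p) k k≗g⁻¹ → proj₁ (invert p) , λ x →
          trans (k≗g⁻¹ x) (trans (sym (proj₂ (invert p) (inv g x)))
                (cong (act (proj₁ (invert p))) (trans (sym (g≗p _)) (inv-right g x)))) }
      }
      where
      p₀ : P
      p₀ = proj₁ (reach base)

    transitive : ∀ u v → ∃[ h ] (H h × fun h u ≡ v)
    transitive u v = aut r , (r , λ _ → refl) , (begin
      act r u                        ≡⟨ proj₂ (compose pv w) u ⟩
      act pv (act w u)               ≡⟨ cong (act pv ∘ act w) (sym (proj₂ (reach u))) ⟩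
      act pv (act w (act pu base))   ≡⟨ cong (act pv) (proj₂ (invert pu) base) ⟩
      act pv base                    ≡⟨ proj₂ (reach v) ⟩
      v                              ∎)
      where
      open ≡-Reasoning
      pu pv w r : P
      pu = proj₁ (reach u)
      pv = proj₁ (reach v)
      w = proj₁ (invert pu)
      r = proj₁ (compose pv w)

    semiregular : ∀ g h u → H g → H h → fun g u ≡ fun h u → ∀ x → fun g x ≡ fun h x
    semiregular g h u (p , g≗p) (p′ , h≗p′) gu≡hu x = begin
      fun g x                    ≡⟨ g≗p x ⟩
      act p x                    ≡⟨ left-inverse-is-right p′ _ ⟨
      act p′ (act w (act p x))   ≡⟨ cong (act p′) (c≡ x) ⟨
      act p′ (act c x)           ≡⟨ cong (act p′) (fixes-one⇒identity c u c-fixes-u x) ⟩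
      act p′ x                   ≡⟨ h≗p′ x ⟨
      fun h x                    ∎
      where
      open ≡-Reasoning
      w c : P
      w = proj₁ (invert p′)
      c = proj₁ (compose w p)
      c≡ : ∀ z → act c z ≡ act w (act p z)
      c≡ = proj₂ (compose w p)
      c-fixes-u : act c u ≡ u
      c-fixes-u = trans (c≡ u) (trans (cong (act w) (trans (sym (g≗p u)) (trans gu≡hu (h≗p′ u))))
                                      (proj₂ (invert p′) u))

    regular : IsRegular V Adj H
    regular = record { transitive = transitive ; semiregular = semiregular }

module Modulo (n : ℕ) .{{_ : NonZero n}} where

  infix 4 _≈_
  data _≈_ (x y : ℤ) : Set where
    differ-by : ∀ w → x ≡ y +ᶻ w *ᶻ + n → x ≈ y

  ≈-reflexive : ∀ {x y} → x ≡ y → x ≈ y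
  ≈-reflexive {x} refl = differ-by 0ℤ (sym (ℤ.+-identityʳ x))

  ≈-sym : ∀ {x y} → x ≈ y → y ≈ x
  ≈-sym {y = y} (differ-by w refl) = differ-by (-ᶻ w) (lemma y w (+ n))
    where
    lemma : ∀ y w n → y ≡ y +ᶻ w *ᶻ n +ᶻ (-ᶻ w) *ᶻ n
    lemma = solve-∀

  ≈-trans : ∀ {x y z} → x ≈ y → y ≈ z → x ≈ z
  ≈-trans {z = z} (differ-by v refl) (differ-by w refl) = differ-by (w +ᶻ v) (lemma z w v (+ n))
    where
    lemma : ∀ z w v n → z +ᶻ w *ᶻ n +ᶻ v *ᶻ n ≡ z +ᶻ (w +ᶻ v) *ᶻ n
    lemma = solve-∀

  ≈-isEquivalence : IsEquivalence _≈_
  ≈-isEquivalence = record { refl = ≈-reflexive refl ; sym = ≈-sym ; trans = ≈-trans }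

  ≈-setoid : Setoid _ _
  ≈-setoid = record { isEquivalence = ≈-isEquivalence }

  module ≈-Reasoning = Relation.Binary.Reasoning.Setoid ≈-setoid

  +-cong : ∀ {x y u v} → x ≈ y → u ≈ v → x +ᶻ u ≈ y +ᶻ v
  +-cong {y = y} {v = v} (differ-by w refl) (differ-by w′ refl) = differ-by (w +ᶻ w′) (lemma y v w w′ (+ n))
    where
    lemma : ∀ y v w w′ n → y +ᶻ w *ᶻ n +ᶻ (v +ᶻ w′ *ᶻ n) ≡ y +ᶻ v +ᶻ (w +ᶻ w′) *ᶻ n
    lemma = solve-∀

  +-congˡ : ∀ {x y} z → x ≈ y → z +ᶻ x ≈ z +ᶻ y
  +-congˡ z = +-cong (≈-reflexive {z} refl)

  +-congʳ : ∀ {x y} z → x ≈ y → x +ᶻ z ≈ y +ᶻ z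
  +-congʳ z x≈y = +-cong x≈y (≈-reflexive {z} refl)

  *-congˡ : ∀ {x y} z → x ≈ y → z *ᶻ x ≈ z *ᶻ y
  *-congˡ {y = y} z (differ-by w refl) = differ-by (z *ᶻ w) (lemma z y w (+ n))
    where
    lemma : ∀ z y w n → z *ᶻ (y +ᶻ w *ᶻ n) ≡ z *ᶻ y +ᶻ z *ᶻ w *ᶻ n
    lemma = solve-∀

  *-congʳ : ∀ {x y} z → x ≈ y → x *ᶻ z ≈ y *ᶻ z
  *-congʳ {x} {y} z x≈y = subst₂ _≈_ (ℤ.*-comm z x) (ℤ.*-comm z y) (*-congˡ z x≈y)

  -‿cong : ∀ {x y} → x ≈ y → -ᶻ x ≈ -ᶻ y
  -‿cong {y = y} (differ-by w refl) = differ-by (-ᶻ w) (lemma y w (+ n))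
    where
    lemma : ∀ y w n → -ᶻ (y +ᶻ w *ᶻ n) ≡ -ᶻ y +ᶻ (-ᶻ w) *ᶻ n
    lemma = solve-∀

  lift : Fin n → ℤ
  lift i = + toℕ i

  opaque
    reduce : ℤ → Fin n
    reduce x = fromℕ< (n%ℕd<d x n)

    lift-reduce : ∀ x → lift (reduce x) ≈ x
    lift-reduce x = ≈-sym (differ-by (x /ℕ n)
      (trans (a≡a%ℕn+[a/ℕn]*n x n) (cong (λ m → + m +ᶻ (x /ℕ n) *ᶻ + n) (sym (Fin.toℕ-fromℕ< _)))))

    toℕ-reduce-+ : ∀ m → toℕ (reduce (+ m)) ≡ m ℕ.% n
    toℕ-reduce-+ m = Fin.toℕ-fromℕ< (n%ℕd<d (+ m) n)

  private
    multiple-below : ∀ {d} → n ℕ.∣ d → d ℕ.< n → d ≡ 0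
    multiple-below {ℕ.zero} _ _ = refl
    multiple-below {ℕ.suc d} n∣d d<n = contradiction (ℕ.∣⇒≤ n∣d) (ℕ.<⇒≱ d<n)

    ordered-residues : ∀ {i j} → i ℕ.≤ j → j ℕ.< n → n ℕ.∣ j ℕ.∸ i → i ≡ j
    ordered-residues {i} {j} i≤j j<n n∣j-i =
      ℕ.≤-antisym i≤j (ℕ.m∸n≡0⇒m≤n (multiple-below n∣j-i (ℕ.≤-<-trans (ℕ.m∸n≤m j i) j<n)))

    residues : ∀ {i j} → i ℕ.< n → j ℕ.< n → n ℕ.∣ ∣ i ⊖ j ∣ → i ≡ j
    residues {i} {j} i<n j<n n∣ with ℕ.≤-total i j
    ... | inj₁ i≤j = ordered-residues i≤j j<n (subst (n ℕ.∣_) (ℤ.∣⊖∣-≤ i≤j) n∣)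
    ... | inj₂ j≤i = sym (ordered-residues j≤i i<n
                     (subst (n ℕ.∣_) (trans (ℤ.∣m⊖n∣≡∣n⊖m∣ i j) (ℤ.∣⊖∣-≤ j≤i)) n∣))

  lift-injective : ∀ {i j} → lift i ≈ lift j → i ≡ j
  lift-injective {i} {j} i≈j = Fin.toℕ-injective (residues (Fin.toℕ<n i) (Fin.toℕ<n j)
    (subst (λ z → n ℕ.∣ ∣ z ∣) (ℤ.m-n≡m⊖n (toℕ i) (toℕ j)) (Signed.∣⇒∣ᵤ (divisor i≈j))))
    where
    divisor : ∀ {x y} → x ≈ y → + n Signed.∣ x -ᶻ y
    divisor {y = y} (differ-by w refl) = Signed.divides w (lemma y w (+ n))
      where
      lemma : ∀ y w n → y +ᶻ w *ᶻ n -ᶻ y ≡ w *ᶻ n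
      lemma = solve-∀

  reduce-cong : ∀ {x y} → x ≈ y → reduce x ≡ reduce y
  reduce-cong {x} {y} x≈y =
    lift-injective (≈-trans (lift-reduce x) (≈-trans x≈y (≈-sym (lift-reduce y))))

  reduce-lift : ∀ i → reduce (lift i) ≡ i
  reduce-lift i = lift-injective (lift-reduce (lift i))

  +[]≡⇒≈ : ∀ i k j → i +[ k ]≡ j → lift i +ᶻ + k ≈ lift j
  +[]≡⇒≈ i k j (q , eq) = differ-by (+ q) (begin
    lift i +ᶻ + k                    ≡⟨ ℤ.pos-+ (toℕ i) k ⟨
    + (toℕ i ℕ.+ k)                  ≡⟨ cong +_ eq ⟩
    + (toℕ j ℕ.+ q ℕ.* n)            ≡⟨ ℤ.pos-+ (toℕ j) (q ℕ.* n) ⟩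
    lift j +ᶻ + (q ℕ.* n)            ≡⟨ cong (lift j +ᶻ_) (ℤ.pos-* q n) ⟩
    lift j +ᶻ + q *ᶻ + n             ∎)
    where open ≡-Reasoning

  ≈⇒+[]≡ : ∀ i k j → lift i +ᶻ + k ≈ lift j → i +[ k ]≡ j
  ≈⇒+[]≡ i k j i+k≈j = m ℕ./ n , (begin
    m                            ≡⟨ ℕ.m≡m%n+[m/n]*n m n ⟩
    m ℕ.% n ℕ.+ m ℕ./ n ℕ.* n    ≡⟨ cong (ℕ._+ m ℕ./ n ℕ.* n) m%n≡j ⟩
    toℕ j ℕ.+ m ℕ./ n ℕ.* n      ∎)
    where
    open ≡-Reasoning
    m : ℕ
    m = toℕ i ℕ.+ k
    m≈j : + m ≈ lift j
    m≈j = subst (_≈ lift j) (sym (ℤ.pos-+ (toℕ i) k)) i+k≈j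
    m%n≡j : m ℕ.% n ≡ toℕ j
    m%n≡j = begin
      m ℕ.% n                ≡⟨ toℕ-reduce-+ m ⟨
      toℕ (reduce (+ m))     ≡⟨ cong toℕ (reduce-cong m≈j) ⟩
      toℕ (reduce (lift j))  ≡⟨ cong toℕ (reduce-lift j) ⟩
      toℕ j                  ∎

parity : ∀ x → ∃[ m ] (x ≡ m *ᶻ + 2 ⊎ x ≡ 1ℤ +ᶻ m *ᶻ + 2)
parity x with x %ℕ 2 | n%ℕd<d x 2 | a≡a%ℕn+[a/ℕn]*n x 2
... | 0 | _ | eq = x /ℕ 2 , inj₁ (trans eq (ℤ.+-identityˡ _))
... | 1 | _ | eq = x /ℕ 2 , inj₂ eq
... | ℕ.suc (ℕ.suc _) | s≤s (s≤s ()) | _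

-- 𝐚 is a parameter, rather than + a, so that an instance can choose the form of
-- it that its ring identities need.
module RoseWindow (n a r : ℕ) .{{_ : NonZero n}} (2a≡n : 2 ℕ.* a ≡ n) (𝐚 : ℤ) (a≡𝐚 : + a ≡ 𝐚) where

  open Modulo n public

  Point : Set
  Point = Bool × ℤ

  data Edge : Point → Point → Set where
    rim   : ∀ {x y} → x +ᶻ 1ℤ ≈ y → Edge (false , x) (false , y)
    hub   : ∀ {x y} → x ≈ y → Edge (false , x) (true , y)
    spoke : ∀ {x y} → y +ᶻ 𝐚 ≈ x → Edge (false , x) (true , y)
    inner : ∀ {x y} → x +ᶻ + r ≈ y → Edge (true , x) (true , y)

  Adjacent : Point → Point → Set
  Adjacent p q = Edge p q ⊎ Edge q p

  liftᵛ : RWVertex n → Point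
  liftᵛ (σ , i) = σ , lift i

  reduceᵛ : Point → RWVertex n
  reduceᵛ (σ , x) = σ , reduce x

  ⟦_⟧ : (Point → Point) → RWVertex n → RWVertex n
  ⟦ f ⟧ = reduceᵛ ∘ f ∘ liftᵛ

  edge-lift : ∀ {u v} → RWEdge n a r u v → Edge (liftᵛ u) (liftᵛ v)
  edge-lift (rim {i} {j} i+1≡j) = rim (+[]≡⇒≈ i 1 j i+1≡j)
  edge-lift hub = hub (≈-reflexive refl)
  edge-lift (spoke {i} {j} i+a≡j) = spoke (subst (λ k → lift i +ᶻ k ≈ lift j) a≡𝐚 (+[]≡⇒≈ i a j i+a≡j))
  edge-lift (inner {i} {j} i+r≡j) = inner (+[]≡⇒≈ i r j i+r≡j)

  reduced : ∀ x {y} k → x +ᶻ k ≈ y → lift (reduce x) +ᶻ k ≈ lift (reduce y)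
  reduced x {y} k x+k≈y = ≈-trans (+-congʳ k (lift-reduce x)) (≈-trans x+k≈y (≈-sym (lift-reduce y)))

  edge-reduce : ∀ {p q} → Edge p q → RWEdge n a r (reduceᵛ p) (reduceᵛ q)
  edge-reduce {_ , x} {_ , y} (rim x+1≈y) = rim (≈⇒+[]≡ (reduce x) 1 (reduce y) (reduced x 1ℤ x+1≈y))
  edge-reduce {_ , x} {_ , y} (hub x≈y) =
    subst (λ i → RWEdge n a r (false , reduce x) (true , i)) (reduce-cong x≈y) hub
  edge-reduce {_ , x} {_ , y} (spoke y+a≈x) =
    spoke (≈⇒+[]≡ (reduce y) a (reduce x) (subst (λ k → lift (reduce y) +ᶻ k ≈ lift (reduce x)) (sym a≡𝐚)
      (reduced y 𝐚 y+a≈x)))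
  edge-reduce {_ , x} {_ , y} (inner x+r≈y) = inner (≈⇒+[]≡ (reduce x) r (reduce y) (reduced x (+ r) x+r≈y))

  ⟦⟧-preserves : ∀ f → (∀ {p q} → Adjacent p q → Adjacent (f p) (f q))
               → Preserves {Adj = RWAdj n a r} ⟦ f ⟧
  ⟦⟧-preserves f f-adj u v (inj₁ e) = ⊎-map edge-reduce edge-reduce (f-adj (inj₁ (edge-lift e)))
  ⟦⟧-preserves f f-adj u v (inj₂ e) = ⊎-map edge-reduce edge-reduce (f-adj (inj₂ (edge-lift e)))

  infix 4 _∼_
  data _∼_ : Point → Point → Set where
    same-sheet : ∀ {σ x y} → x ≈ y → (σ , x) ∼ (σ , y)

  Congruent : (Point → Point) → Set
  Congruent f = ∀ {p q} → p ∼ q → f p ∼ f q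

  reduceᵛ-cong : ∀ {p q} → p ∼ q → reduceᵛ p ≡ reduceᵛ q
  reduceᵛ-cong (same-sheet x≈y) = cong (_ ,_) (reduce-cong x≈y)

  liftᵛ-reduceᵛ : ∀ p → liftᵛ (reduceᵛ p) ∼ p
  liftᵛ-reduceᵛ (_ , x) = same-sheet (lift-reduce x)

  ⟦⟧-∘ : ∀ f g → Congruent f → ∀ v → ⟦ f ⟧ (⟦ g ⟧ v) ≡ ⟦ f ∘ g ⟧ v
  ⟦⟧-∘ f g f-cong v = reduceᵛ-cong (f-cong (liftᵛ-reduceᵛ (g (liftᵛ v))))

  ⟦⟧-cong : ∀ f g → (∀ p → f p ∼ g p) → ∀ v → ⟦ f ⟧ v ≡ ⟦ g ⟧ v
  ⟦⟧-cong f g f∼g v = reduceᵛ-cong (f∼g (liftᵛ v))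

  ⟦⟧-identity : ∀ f → (∀ p → f p ∼ p) → ∀ v → ⟦ f ⟧ v ≡ v
  ⟦⟧-identity f f∼id (σ , i) = trans (reduceᵛ-cong (f∼id (σ , lift i))) (cong (σ ,_) (reduce-lift i))

  ⟦⟧-fixed : ∀ f v → ⟦ f ⟧ v ≡ v → f (liftᵛ v) ∼ liftᵛ v
  ⟦⟧-fixed f (σ , i) eq with f (σ , lift i) | eq
  ... | (.σ , x) | refl = same-sheet (≈-sym (lift-reduce x))

  ⟦⟧-inverse : ∀ f g → Congruent f → (∀ p → f (g p) ∼ p) → ∀ v → ⟦ f ⟧ (⟦ g ⟧ v) ≡ v
  ⟦⟧-inverse f g f-cong fg v = trans (⟦⟧-∘ f g f-cong v) (⟦⟧-identity (f ∘ g) fg v)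

  ⟦⟧-commute : ∀ f g f′ g′ → Congruent f → Congruent f′ → (∀ p → f (g p) ∼ f′ (g′ p))
             → ∀ v → ⟦ f ⟧ (⟦ g ⟧ v) ≡ ⟦ f′ ⟧ (⟦ g′ ⟧ v)
  ⟦⟧-commute f g f′ g′ f-cong f′-cong fg∼f′g′ v =
    trans (⟦⟧-∘ f g f-cong v)
          (trans (⟦⟧-cong (f ∘ g) (f′ ∘ g′) fg∼f′g′ v) (sym (⟦⟧-∘ f′ g′ f′-cong v)))

  ∼-trans : ∀ {p q s} → p ∼ q → q ∼ s → p ∼ s
  ∼-trans (same-sheet x≈y) (same-sheet y≈z) = same-sheet (≈-trans x≈y y≈z)

  ∼⇒≈ : ∀ {σ x y} → (σ , x) ∼ (σ , y) → x ≈ y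
  ∼⇒≈ (same-sheet x≈y) = x≈y

  Adjacent-sym : ∀ {p q} → Adjacent p q → Adjacent q p
  Adjacent-sym (inj₁ e) = inj₂ e
  Adjacent-sym (inj₂ e) = inj₁ e

  edge-preserving : ∀ (f : Point → Point) → (∀ {p q} → Edge p q → Adjacent (f p) (f q))
                  → ∀ {p q} → Adjacent p q → Adjacent (f p) (f q)
  edge-preserving f f-edge (inj₁ e) = f-edge e
  edge-preserving f f-edge {p} {q} (inj₂ e) = Adjacent-sym {f q} {f p} (f-edge e)

  2𝐚≡n : + 2 *ᶻ 𝐚 ≡ + n
  2𝐚≡n = begin
    + 2 *ᶻ 𝐚       ≡⟨ cong (+ 2 *ᶻ_) a≡𝐚 ⟨
    + 2 *ᶻ + a     ≡⟨ ℤ.pos-* 2 a ⟨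
    + (2 ℕ.* a)    ≡⟨ cong +_ 2a≡n ⟩
    + n            ∎
    where open ≡-Reasoning

  a+a≈0 : 𝐚 +ᶻ 𝐚 ≈ 0ℤ
  a+a≈0 = differ-by 1ℤ (trans (lemma 𝐚) (cong (λ m → 0ℤ +ᶻ 1ℤ *ᶻ m) 2𝐚≡n))
    where
    lemma : ∀ a → a +ᶻ a ≡ 0ℤ +ᶻ 1ℤ *ᶻ (+ 2 *ᶻ a)
    lemma = solve-∀

  a*even≈0 : ∀ m → 𝐚 *ᶻ (m *ᶻ + 2) ≈ 0ℤ
  a*even≈0 m = differ-by m (trans (lemma 𝐚 m) (cong (λ k → 0ℤ +ᶻ m *ᶻ k) 2𝐚≡n))
    where
    lemma : ∀ a m → a *ᶻ (m *ᶻ + 2) ≡ 0ℤ +ᶻ m *ᶻ (+ 2 *ᶻ a)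
    lemma = solve-∀

  a*odd≈a : ∀ m → 𝐚 *ᶻ (1ℤ +ᶻ m *ᶻ + 2) ≈ 𝐚
  a*odd≈a m = begin
    𝐚 *ᶻ (1ℤ +ᶻ m *ᶻ + 2)          ≡⟨ ℤ.*-distribˡ-+ 𝐚 1ℤ (m *ᶻ + 2) ⟩
    𝐚 *ᶻ 1ℤ +ᶻ 𝐚 *ᶻ (m *ᶻ + 2)   ≈⟨ +-congˡ (𝐚 *ᶻ 1ℤ) (a*even≈0 m) ⟩
    𝐚 *ᶻ 1ℤ +ᶻ 0ℤ                  ≡⟨ trans (ℤ.+-identityʳ _) (ℤ.*-identityʳ 𝐚) ⟩
    𝐚                              ∎
    where open ≈-Reasoning

  a*x≈0⊎a : ∀ x → 𝐚 *ᶻ x ≈ 0ℤ ⊎ 𝐚 *ᶻ x ≈ 𝐚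
  a*x≈0⊎a x with parity x
  ... | m , inj₁ refl = inj₁ (a*even≈0 m)
  ... | m , inj₂ refl = inj₂ (a*odd≈a m)

  translate : (Bool → ℤ) → Point → Point
  translate δ (σ , x) = σ , x +ᶻ δ σ

  translate-congruent : ∀ δ → Congruent (translate δ)
  translate-congruent δ (same-sheet {σ} x≈y) = same-sheet (+-congʳ (δ σ) x≈y)

  translate-adjacent : ∀ δ → δ true ≈ δ false ⊎ δ true ≈ δ false +ᶻ 𝐚
                     → ∀ {p q} → Adjacent p q → Adjacent (translate δ p) (translate δ q)
  translate-adjacent δ B≈A∨A+a = edge-preserving (translate δ) edge
    where
    open ≈-Reasoning
    α β : ℤ
    α = δ false
    β = δ true
    translated : ∀ x {y} k γ → x +ᶻ k ≈ y → x +ᶻ γ +ᶻ k ≈ y +ᶻ γ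
    translated x {y} k γ x+k≈y = begin
      x +ᶻ γ +ᶻ k   ≡⟨ lemma x γ k ⟩
      x +ᶻ k +ᶻ γ   ≈⟨ +-congʳ γ x+k≈y ⟩
      y +ᶻ γ        ∎
      where
      lemma : ∀ x γ k → x +ᶻ γ +ᶻ k ≡ x +ᶻ k +ᶻ γ
      lemma = solve-∀
    hub-image : ∀ {x y} → x ≈ y → β ≈ α ⊎ β ≈ α +ᶻ 𝐚
              → Adjacent (false , x +ᶻ α) (true , y +ᶻ β)
    hub-image x≈y (inj₁ β≈α) = inj₁ (hub (+-cong x≈y (≈-sym β≈α)))
    hub-image {x} {y} x≈y (inj₂ β≈α+a) = inj₁ (spoke (begin
      y +ᶻ β +ᶻ 𝐚              ≈⟨ +-congʳ 𝐚 (+-congˡ y β≈α+a) ⟩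
      y +ᶻ (α +ᶻ 𝐚) +ᶻ 𝐚       ≡⟨ lemma y α 𝐚 ⟩
      y +ᶻ α +ᶻ (𝐚 +ᶻ 𝐚)       ≈⟨ +-congˡ (y +ᶻ α) a+a≈0 ⟩
      y +ᶻ α +ᶻ 0ℤ             ≡⟨ ℤ.+-identityʳ (y +ᶻ α) ⟩
      y +ᶻ α                   ≈⟨ +-congʳ α (≈-sym x≈y) ⟩
      x +ᶻ α                   ∎))
      where
      lemma : ∀ y α a → y +ᶻ (α +ᶻ a) +ᶻ a ≡ y +ᶻ α +ᶻ (a +ᶻ a)
      lemma = solve-∀
    spoke-image : ∀ {x y} → y +ᶻ 𝐚 ≈ x → β ≈ α ⊎ β ≈ α +ᶻ 𝐚
                → Adjacent (false , x +ᶻ α) (true , y +ᶻ β)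
    spoke-image {x} {y} y+a≈x (inj₁ β≈α) = inj₁ (spoke (begin
      y +ᶻ β +ᶻ 𝐚              ≈⟨ +-congʳ 𝐚 (+-congˡ y β≈α) ⟩
      y +ᶻ α +ᶻ 𝐚              ≈⟨ translated y 𝐚 α y+a≈x ⟩
      x +ᶻ α                   ∎))
    spoke-image {x} {y} y+a≈x (inj₂ β≈α+a) = inj₁ (hub (begin
      x +ᶻ α                   ≈⟨ +-congʳ α (≈-sym y+a≈x) ⟩
      y +ᶻ 𝐚 +ᶻ α              ≡⟨ lemma y α 𝐚 ⟩
      y +ᶻ (α +ᶻ 𝐚)            ≈⟨ +-congˡ y (≈-sym β≈α+a) ⟩
      y +ᶻ β                   ∎))
      where
      lemma : ∀ y α a → y +ᶻ a +ᶻ α ≡ y +ᶻ (α +ᶻ a)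
      lemma = solve-∀
    edge : ∀ {p q} → Edge p q → Adjacent (translate δ p) (translate δ q)
    edge (rim {x} x+1≈y) = inj₁ (rim (translated x 1ℤ α x+1≈y))
    edge (inner {x} x+r≈y) = inj₁ (inner (translated x (+ r) β x+r≈y))
    edge (hub x≈y) = hub-image x≈y B≈A∨A+a
    edge (spoke {x} {y} y+a≈x) = spoke-image {x} {y} y+a≈x B≈A∨A+a

  reflect : Point → Point
  reflect (σ , x) = σ , 1ℤ -ᶻ x

  reflect-congruent : Congruent reflect
  reflect-congruent (same-sheet x≈y) = same-sheet (+-congˡ 1ℤ (-‿cong x≈y))

  reflect-adjacent : ∀ {p q} → Adjacent p q → Adjacent (reflect p) (reflect q)
  reflect-adjacent = edge-preserving reflect edge
    where
    open ≈-Reasoning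
    reverse : ∀ x {y} k → x +ᶻ k ≈ y → 1ℤ -ᶻ y +ᶻ k ≈ 1ℤ -ᶻ x
    reverse x {y} k x+k≈y = begin
      1ℤ -ᶻ y +ᶻ k              ≈⟨ +-congʳ k (+-congˡ 1ℤ (-‿cong (≈-sym x+k≈y))) ⟩
      1ℤ -ᶻ (x +ᶻ k) +ᶻ k       ≡⟨ lemma x k ⟩
      1ℤ -ᶻ x                   ∎
      where
      lemma : ∀ x k → 1ℤ -ᶻ (x +ᶻ k) +ᶻ k ≡ 1ℤ -ᶻ x
      lemma = solve-∀
    edge : ∀ {p q} → Edge p q → Adjacent (reflect p) (reflect q)
    edge (rim {x} x+1≈y) = inj₂ (rim (reverse x 1ℤ x+1≈y))
    edge (inner {x} x+r≈y) = inj₂ (inner (reverse x (+ r) x+r≈y))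
    edge (hub x≈y) = inj₁ (hub (+-congˡ 1ℤ (-‿cong x≈y)))
    edge {false , x} {true , y} (spoke y+a≈x) = inj₁ (spoke (begin
      1ℤ -ᶻ y +ᶻ 𝐚                     ≡⟨ lemma y 𝐚 ⟩
      1ℤ -ᶻ (y +ᶻ 𝐚) +ᶻ (𝐚 +ᶻ 𝐚)   ≈⟨ +-cong (+-congˡ 1ℤ (-‿cong y+a≈x)) a+a≈0 ⟩
      1ℤ -ᶻ x +ᶻ 0ℤ                      ≡⟨ ℤ.+-identityʳ (1ℤ -ᶻ x) ⟩
      1ℤ -ᶻ x                            ∎))
      where
      lemma : ∀ y a → 1ℤ -ᶻ y +ᶻ a ≡ 1ℤ -ᶻ (y +ᶻ a) +ᶻ (a +ᶻ a)
      lemma = solve-∀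

  reflect-involutive : ∀ p → reflect (reflect p) ∼ p
  reflect-involutive (_ , x) = same-sheet (≈-reflexive (lemma x))
    where
    lemma : ∀ x → 1ℤ -ᶻ (1ℤ -ᶻ x) ≡ x
    lemma = solve-∀

  rate : Bool → ℤ
  rate false = + 2
  rate true = + 2 +ᶻ 𝐚

  glide : ℤ → Point → Point
  glide k = translate (λ σ → rate σ *ᶻ k)

  glide-congruent : ∀ k → Congruent (glide k)
  glide-congruent k = translate-congruent (λ σ → rate σ *ᶻ k)

  glide-adjacent : ∀ k {p q} → Adjacent p q → Adjacent (glide k p) (glide k q)
  glide-adjacent k = translate-adjacent (λ σ → rate σ *ᶻ k) (⊎-map shift-0 shift-a (a*x≈0⊎a k))
    where
    open ≈-Reasoning
    shift-0 : 𝐚 *ᶻ k ≈ 0ℤ → (+ 2 +ᶻ 𝐚) *ᶻ k ≈ + 2 *ᶻ k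
    shift-0 ak≈0 = begin
      (+ 2 +ᶻ 𝐚) *ᶻ k        ≡⟨ ℤ.*-distribʳ-+ k (+ 2) 𝐚 ⟩
      + 2 *ᶻ k +ᶻ 𝐚 *ᶻ k     ≈⟨ +-congˡ (+ 2 *ᶻ k) ak≈0 ⟩
      + 2 *ᶻ k +ᶻ 0ℤ         ≡⟨ ℤ.+-identityʳ (+ 2 *ᶻ k) ⟩
      + 2 *ᶻ k               ∎
    shift-a : 𝐚 *ᶻ k ≈ 𝐚 → (+ 2 +ᶻ 𝐚) *ᶻ k ≈ + 2 *ᶻ k +ᶻ 𝐚
    shift-a ak≈a = begin
      (+ 2 +ᶻ 𝐚) *ᶻ k        ≡⟨ ℤ.*-distribʳ-+ k (+ 2) 𝐚 ⟩
      + 2 *ᶻ k +ᶻ 𝐚 *ᶻ k     ≈⟨ +-congˡ (+ 2 *ᶻ k) ak≈a ⟩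
      + 2 *ᶻ k +ᶻ 𝐚          ∎

  glide-glide : ∀ k l p → glide k (glide l p) ∼ glide (k +ᶻ l) p
  glide-glide k l (σ , x) = same-sheet (≈-reflexive (lemma x (rate σ) k l))
    where
    lemma : ∀ x m k l → x +ᶻ m *ᶻ l +ᶻ m *ᶻ k ≡ x +ᶻ m *ᶻ (k +ᶻ l)
    lemma = solve-∀

  glide-zero : ∀ p → glide 0ℤ p ∼ p
  glide-zero (σ , x) = same-sheet (≈-reflexive (trans (cong (x +ᶻ_) (ℤ.*-zeroʳ (rate σ))) (ℤ.+-identityʳ x)))

  reflect-glide : ∀ k p → reflect (glide k p) ∼ glide (-ᶻ k) (reflect p)
  reflect-glide k (σ , x) = same-sheet (≈-reflexive (lemma x (rate σ) k))
    where
    lemma : ∀ x m k → 1ℤ -ᶻ (x +ᶻ m *ᶻ k) ≡ 1ℤ -ᶻ x +ᶻ m *ᶻ (-ᶻ k)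
    lemma = solve-∀

  reflected-glide-moves-everything : ∀ x k → ¬ (1ℤ -ᶻ x +ᶻ + 2 *ᶻ k ≈ x)
  reflected-glide-moves-everything x k (differ-by w eq) = 1≢2* (x -ᶻ k +ᶻ w *ᶻ 𝐚) (begin
    1ℤ                                           ≡⟨ lemma₁ x k ⟩
    1ℤ -ᶻ x +ᶻ + 2 *ᶻ k +ᶻ (x -ᶻ + 2 *ᶻ k)        ≡⟨ cong (_+ᶻ (x -ᶻ + 2 *ᶻ k)) eq ⟩
    x +ᶻ w *ᶻ + n +ᶻ (x -ᶻ + 2 *ᶻ k)              ≡⟨ cong (λ m → x +ᶻ w *ᶻ m +ᶻ (x -ᶻ + 2 *ᶻ k)) 2𝐚≡n ⟨
    x +ᶻ w *ᶻ (+ 2 *ᶻ 𝐚) +ᶻ (x -ᶻ + 2 *ᶻ k)      ≡⟨ lemma₂ x k w 𝐚 ⟩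
    + 2 *ᶻ (x -ᶻ k +ᶻ w *ᶻ 𝐚)                    ∎)
    where
    open ≡-Reasoning
    lemma₁ : ∀ x k → 1ℤ ≡ 1ℤ -ᶻ x +ᶻ + 2 *ᶻ k +ᶻ (x -ᶻ + 2 *ᶻ k)
    lemma₁ = solve-∀
    lemma₂ : ∀ x k w a → x +ᶻ w *ᶻ (+ 2 *ᶻ a) +ᶻ (x -ᶻ + 2 *ᶻ k) ≡ + 2 *ᶻ (x -ᶻ k +ᶻ w *ᶻ a)
    lemma₂ = solve-∀
    1≢2* : ∀ m → 1ℤ ≢ + 2 *ᶻ m
    1≢2* m eq with ℕ.m*n≡1⇒m≡1 2 ∣ m ∣ (sym (trans (cong ∣_∣ eq) (ℤ.abs-* (+ 2) m)))
    ... | ()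

  module Swap (c : ℤ) (c-odd : ∃[ h ] c ≡ 1ℤ +ᶻ h *ᶻ + 2)
              (c≈±r : c ≈ + r ⊎ c ≈ -ᶻ + r) (c²+a≈1 : c *ᶻ c +ᶻ 𝐚 ≈ 1ℤ) where

    c′ : ℤ
    c′ = c +ᶻ 𝐚

    swap : Point → Point
    swap (false , x) = true , c *ᶻ x
    swap (true , x) = false , c′ *ᶻ x

    swap-congruent : Congruent swap
    swap-congruent (same-sheet {false} x≈y) = same-sheet (*-congˡ c x≈y)
    swap-congruent (same-sheet {true} x≈y) = same-sheet (*-congˡ c′ x≈y)

    open ≈-Reasoning

    c*a≈a : c *ᶻ 𝐚 ≈ 𝐚
    c*a≈a = subst (_≈ 𝐚) (trans (cong (𝐚 *ᶻ_) (sym (proj₂ c-odd))) (ℤ.*-comm 𝐚 c))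
                  (a*odd≈a (proj₁ c-odd))

    c*c′≈1 : c *ᶻ c′ ≈ 1ℤ
    c*c′≈1 = begin
      c *ᶻ (c +ᶻ 𝐚)       ≡⟨ ℤ.*-distribˡ-+ c c 𝐚 ⟩
      c *ᶻ c +ᶻ c *ᶻ 𝐚    ≈⟨ +-congˡ (c *ᶻ c) c*a≈a ⟩
      c *ᶻ c +ᶻ 𝐚         ≈⟨ c²+a≈1 ⟩
      1ℤ                    ∎

    swap-involutive : ∀ p → swap (swap p) ∼ p
    swap-involutive (false , x) = same-sheet (begin
      c′ *ᶻ (c *ᶻ x)     ≡⟨ ℤ.*-assoc c′ c x ⟨
      c′ *ᶻ c *ᶻ x       ≡⟨ cong (_*ᶻ x) (ℤ.*-comm c′ c) ⟩
      c *ᶻ c′ *ᶻ x       ≈⟨ *-congʳ x c*c′≈1 ⟩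
      1ℤ *ᶻ x            ≡⟨ ℤ.*-identityˡ x ⟩
      x                  ∎)
    swap-involutive (true , x) = same-sheet (begin
      c *ᶻ (c′ *ᶻ x)     ≡⟨ ℤ.*-assoc c c′ x ⟨
      c *ᶻ c′ *ᶻ x       ≈⟨ *-congʳ x c*c′≈1 ⟩
      1ℤ *ᶻ x            ≡⟨ ℤ.*-identityˡ x ⟩
      x                  ∎)

    private
      cancel : ∀ u {v w} → v ≈ -ᶻ w → u +ᶻ v +ᶻ w ≈ u
      cancel u {v} {w} v≈-w = begin
        u +ᶻ v +ᶻ w            ≈⟨ +-congʳ w (+-congˡ u v≈-w) ⟩
        u +ᶻ -ᶻ w +ᶻ w         ≡⟨ lemma u w ⟩
        u                      ∎
        where
        lemma : ∀ u w → u +ᶻ -ᶻ w +ᶻ w ≡ u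
        lemma = solve-∀

      scale : ∀ m {x y} k → x +ᶻ k ≈ y → m *ᶻ y ≈ m *ᶻ x +ᶻ m *ᶻ k
      scale m {x} k x+k≈y = ≈-trans (*-congˡ m (≈-sym x+k≈y)) (≈-reflexive (ℤ.*-distribˡ-+ m x k))

      c′y≈cy+0⊎a : ∀ y → c′ *ᶻ y ≈ c *ᶻ y +ᶻ 0ℤ ⊎ c′ *ᶻ y ≈ c *ᶻ y +ᶻ 𝐚
      c′y≈cy+0⊎a y = ⊎-map (add-on-right 0ℤ) (add-on-right 𝐚) (a*x≈0⊎a y)
        where
        add-on-right : ∀ δ → 𝐚 *ᶻ y ≈ δ → c′ *ᶻ y ≈ c *ᶻ y +ᶻ δ
        add-on-right δ ay≈δ = ≈-trans (≈-reflexive (ℤ.*-distribʳ-+ y c 𝐚)) (+-congˡ (c *ᶻ y) ay≈δ)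

      rim-image : ∀ {x y} → x +ᶻ 1ℤ ≈ y → c ≈ + r ⊎ c ≈ -ᶻ + r
                → Adjacent (true , c *ᶻ x) (true , c *ᶻ y)
      rim-image {x} {y} x+1≈y (inj₁ c≈r) = inj₁ (inner (begin
        c *ᶻ x +ᶻ + r          ≈⟨ +-congˡ (c *ᶻ x) (≈-sym c≈r) ⟩
        c *ᶻ x +ᶻ c            ≡⟨ cong (c *ᶻ x +ᶻ_) (ℤ.*-identityʳ c) ⟨
        c *ᶻ x +ᶻ c *ᶻ 1ℤ      ≈⟨ scale c 1ℤ x+1≈y ⟨
        c *ᶻ y                 ∎))
      rim-image {x} {y} x+1≈y (inj₂ c≈-r) = inj₂ (inner (begin
        c *ᶻ y +ᶻ + r              ≈⟨ +-congʳ (+ r) (scale c 1ℤ x+1≈y) ⟩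
        c *ᶻ x +ᶻ c *ᶻ 1ℤ +ᶻ + r   ≡⟨ cong (λ z → c *ᶻ x +ᶻ z +ᶻ + r) (ℤ.*-identityʳ c) ⟩
        c *ᶻ x +ᶻ c +ᶻ + r         ≈⟨ cancel (c *ᶻ x) c≈-r ⟩
        c *ᶻ x                     ∎))

      c′*c≈1 : c′ *ᶻ c ≈ 1ℤ
      c′*c≈1 = subst (_≈ 1ℤ) (ℤ.*-comm c c′) c*c′≈1

      inner-image : ∀ {x y} → x +ᶻ + r ≈ y → c ≈ + r ⊎ c ≈ -ᶻ + r
                  → Adjacent (false , c′ *ᶻ x) (false , c′ *ᶻ y)
      inner-image {x} {y} x+r≈y (inj₁ c≈r) = inj₁ (rim (begin
        c′ *ᶻ x +ᶻ 1ℤ              ≈⟨ +-congˡ (c′ *ᶻ x) (≈-sym c′*c≈1) ⟩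
        c′ *ᶻ x +ᶻ c′ *ᶻ c         ≈⟨ +-congˡ (c′ *ᶻ x) (*-congˡ c′ c≈r) ⟩
        c′ *ᶻ x +ᶻ c′ *ᶻ + r       ≈⟨ scale c′ (+ r) x+r≈y ⟨
        c′ *ᶻ y                    ∎))
      inner-image {x} {y} x+r≈y (inj₂ c≈-r) = inj₂ (rim (begin
        c′ *ᶻ y +ᶻ 1ℤ              ≈⟨ +-congʳ 1ℤ (scale c′ (+ r) x+r≈y) ⟩
        c′ *ᶻ x +ᶻ c′ *ᶻ + r +ᶻ 1ℤ ≈⟨ cancel (c′ *ᶻ x) c′r≈-1 ⟩
        c′ *ᶻ x                    ∎))
        where
        c′r≈-1 : c′ *ᶻ + r ≈ -ᶻ 1ℤ
        c′r≈-1 = begin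
          c′ *ᶻ + r                ≡⟨ cong (c′ *ᶻ_) (ℤ.neg-involutive (+ r)) ⟨
          c′ *ᶻ -ᶻ -ᶻ + r          ≈⟨ *-congˡ c′ (-‿cong (≈-sym c≈-r)) ⟩
          c′ *ᶻ -ᶻ c               ≡⟨ ℤ.neg-distribʳ-* c′ c ⟨
          -ᶻ (c′ *ᶻ c)             ≈⟨ -‿cong c′*c≈1 ⟩
          -ᶻ 1ℤ                    ∎

      hub-image : ∀ {x y} → x ≈ y → Adjacent (true , c *ᶻ x) (false , c′ *ᶻ y)
      hub-image {x} {y} x≈y = [ to-hub , to-spoke ]′ (c′y≈cy+0⊎a y)
        where
        to-hub : c′ *ᶻ y ≈ c *ᶻ y +ᶻ 0ℤ → Adjacent (true , c *ᶻ x) (false , c′ *ᶻ y)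
        to-hub c′y≈cy = inj₂ (hub (≈-trans c′y≈cy (≈-trans (≈-reflexive (ℤ.+-identityʳ (c *ᶻ y)))
                                                             (*-congˡ c (≈-sym x≈y)))))
        to-spoke : c′ *ᶻ y ≈ c *ᶻ y +ᶻ 𝐚 → Adjacent (true , c *ᶻ x) (false , c′ *ᶻ y)
        to-spoke c′y≈cy+a = inj₂ (spoke (≈-trans (+-congʳ 𝐚 (*-congˡ c x≈y)) (≈-sym c′y≈cy+a)))

      spoke-image : ∀ {x y} → y +ᶻ 𝐚 ≈ x → Adjacent (true , c *ᶻ x) (false , c′ *ᶻ y)
      spoke-image {x} {y} y+a≈x = [ to-spoke , to-hub ]′ (c′y≈cy+0⊎a y)
        where
        cx≈cy+a : c *ᶻ x ≈ c *ᶻ y +ᶻ 𝐚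
        cx≈cy+a = ≈-trans (scale c 𝐚 y+a≈x) (+-congˡ (c *ᶻ y) c*a≈a)
        to-spoke : c′ *ᶻ y ≈ c *ᶻ y +ᶻ 0ℤ → Adjacent (true , c *ᶻ x) (false , c′ *ᶻ y)
        to-spoke c′y≈cy = inj₂ (spoke (begin
          c *ᶻ x +ᶻ 𝐚              ≈⟨ +-congʳ 𝐚 cx≈cy+a ⟩
          c *ᶻ y +ᶻ 𝐚 +ᶻ 𝐚         ≡⟨ ℤ.+-assoc (c *ᶻ y) 𝐚 𝐚 ⟩
          c *ᶻ y +ᶻ (𝐚 +ᶻ 𝐚)       ≈⟨ +-congˡ (c *ᶻ y) a+a≈0 ⟩
          c *ᶻ y +ᶻ 0ℤ             ≈⟨ c′y≈cy ⟨
          c′ *ᶻ y                  ∎))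
        to-hub : c′ *ᶻ y ≈ c *ᶻ y +ᶻ 𝐚 → Adjacent (true , c *ᶻ x) (false , c′ *ᶻ y)
        to-hub c′y≈cy+a = inj₂ (hub (≈-trans c′y≈cy+a (≈-sym cx≈cy+a)))

      edge : ∀ {p q} → Edge p q → Adjacent (swap p) (swap q)
      edge (rim x+1≈y) = rim-image x+1≈y c≈±r
      edge (inner x+r≈y) = inner-image x+r≈y c≈±r
      edge (hub x≈y) = hub-image x≈y
      edge (spoke y+a≈x) = spoke-image y+a≈x

    swap-adjacent : ∀ {p q} → Adjacent p q → Adjacent (swap p) (swap q)
    swap-adjacent = edge-preserving swap edge

module RegularSubgroup (D : ℕ) .{{_ : NonZero D}} (r : ℕ) (t : ℤ) where

  𝐃 : ℤ
  𝐃 = + D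

  instance
    8D≢0 : NonZero (8 ℕ.* D)
    8D≢0 = ℕ.m*n≢0 8 D

  open RoseWindow (8 ℕ.* D) (4 ℕ.* D) r (sym (ℕ.*-assoc 2 4 D)) (+ 4 *ᶻ 𝐃) (ℤ.pos-* 4 D) public

  multiple-of-8D : ∀ {x y} w → x ≡ y +ᶻ w *ᶻ (+ 8 *ᶻ 𝐃) → x ≈ y
  multiple-of-8D {y = y} w eq = differ-by w (trans eq (cong (λ N → y +ᶻ w *ᶻ N) (sym (ℤ.pos-* 8 D))))

  c u w : ℤ
  c = + 3 +ᶻ + 4 *ᶻ t
  u = c +ᶻ + 2 *ᶻ 𝐃
  w = 1ℤ +ᶻ + 2 *ᶻ t +ᶻ + 2 *ᶻ 𝐃

  c-odd : ∃[ h ] c ≡ 1ℤ +ᶻ h *ᶻ + 2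
  c-odd = 1ℤ +ᶻ + 2 *ᶻ t , lemma t
    where
    lemma : ∀ t → + 3 +ᶻ + 4 *ᶻ t ≡ 1ℤ +ᶻ (1ℤ +ᶻ + 2 *ᶻ t) *ᶻ + 2
    lemma = solve-∀

  module _ (c≈±r : c ≈ + r ⊎ c ≈ -ᶻ + r) (c²+a≈1 : c *ᶻ c +ᶻ + 4 *ᶻ 𝐃 ≈ 1ℤ) where

    open Swap c c-odd c≈±r c²+a≈1

    swap-glide : ∀ k p → swap (glide k p) ∼ glide (u *ᶻ k) (swap p)
    swap-glide k (false , x) = same-sheet (multiple-of-8D (-ᶻ ((+ 2 +ᶻ + 2 *ᶻ t +ᶻ 𝐃) *ᶻ k)) (lemma t 𝐃 k x))
      where
      lemma : ∀ t D k x → (+ 3 +ᶻ + 4 *ᶻ t) *ᶻ (x +ᶻ + 2 *ᶻ k)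
            ≡ (+ 3 +ᶻ + 4 *ᶻ t) *ᶻ x +ᶻ (+ 2 +ᶻ + 4 *ᶻ D) *ᶻ ((+ 3 +ᶻ + 4 *ᶻ t +ᶻ + 2 *ᶻ D) *ᶻ k)
              +ᶻ (-ᶻ ((+ 2 +ᶻ + 2 *ᶻ t +ᶻ D) *ᶻ k)) *ᶻ (+ 8 *ᶻ D)
      lemma = solve-∀
    swap-glide k (true , x) = same-sheet (multiple-of-8D ((+ 2 +ᶻ + 2 *ᶻ t +ᶻ + 2 *ᶻ 𝐃) *ᶻ k) (lemma t 𝐃 k x))
      where
      lemma : ∀ t D k x → (+ 3 +ᶻ + 4 *ᶻ t +ᶻ + 4 *ᶻ D) *ᶻ (x +ᶻ (+ 2 +ᶻ + 4 *ᶻ D) *ᶻ k)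
            ≡ (+ 3 +ᶻ + 4 *ᶻ t +ᶻ + 4 *ᶻ D) *ᶻ x +ᶻ + 2 *ᶻ ((+ 3 +ᶻ + 4 *ᶻ t +ᶻ + 2 *ᶻ D) *ᶻ k)
              +ᶻ ((+ 2 +ᶻ + 2 *ᶻ t +ᶻ + 2 *ᶻ D) *ᶻ k) *ᶻ (+ 8 *ᶻ D)
      lemma = solve-∀

    swap-reflect : ∀ p → swap (reflect p) ∼ glide w (reflect (swap p))
    swap-reflect (false , x) = same-sheet (multiple-of-8D (-ᶻ (1ℤ +ᶻ t +ᶻ 𝐃)) (lemma t 𝐃 x))
      where
      lemma : ∀ t D x → (+ 3 +ᶻ + 4 *ᶻ t) *ᶻ (1ℤ -ᶻ x)
            ≡ 1ℤ -ᶻ (+ 3 +ᶻ + 4 *ᶻ t) *ᶻ x +ᶻ (+ 2 +ᶻ + 4 *ᶻ D) *ᶻ (1ℤ +ᶻ + 2 *ᶻ t +ᶻ + 2 *ᶻ D)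
              +ᶻ (-ᶻ (1ℤ +ᶻ t +ᶻ D)) *ᶻ (+ 8 *ᶻ D)
      lemma = solve-∀
    swap-reflect (true , x) = same-sheet (≈-reflexive (lemma t 𝐃 x))
      where
      lemma : ∀ t D x → (+ 3 +ᶻ + 4 *ᶻ t +ᶻ + 4 *ᶻ D) *ᶻ (1ℤ -ᶻ x)
            ≡ 1ℤ -ᶻ (+ 3 +ᶻ + 4 *ᶻ t +ᶻ + 4 *ᶻ D) *ᶻ x +ᶻ + 2 *ᶻ (1ℤ +ᶻ + 2 *ᶻ t +ᶻ + 2 *ᶻ D)
      lemma = solve-∀

    Vertex : Set
    Vertex = RWVertex (8 ℕ.* D)

    Aut : Set
    Aut = Automorphism Vertex (RWAdj (8 ℕ.* D) (4 ℕ.* D) r)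

    glideᵃ : ℤ → Aut
    glideᵃ k = automorphism ⟦ glide k ⟧ ⟦ glide (-ᶻ k) ⟧
      (⟦⟧-inverse (glide (-ᶻ k)) (glide k) (glide-congruent (-ᶻ k)) (cancel (-ᶻ k) k (ℤ.+-inverseˡ k)))
      (⟦⟧-inverse (glide k) (glide (-ᶻ k)) (glide-congruent k) (cancel k (-ᶻ k) (ℤ.+-inverseʳ k)))
      (⟦⟧-preserves (glide k) (glide-adjacent k)) (⟦⟧-preserves (glide (-ᶻ k)) (glide-adjacent (-ᶻ k)))
      where
      cancel : ∀ l k → l +ᶻ k ≡ 0ℤ → ∀ p → glide l (glide k p) ∼ p
      cancel l k l+k≡0 p = ∼-trans (glide-glide l k p) (subst (λ m → glide m p ∼ p) (sym l+k≡0) (glide-zero p))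

    reflectᵃ : Aut
    reflectᵃ = involution ⟦ reflect ⟧ (⟦⟧-inverse reflect reflect reflect-congruent reflect-involutive)
                                      (⟦⟧-preserves reflect reflect-adjacent)

    swapᵃ : Aut
    swapᵃ = involution ⟦ swap ⟧ (⟦⟧-inverse swap swap swap-congruent swap-involutive)
                                (⟦⟧-preserves swap swap-adjacent)

    glideᵛ : ℤ → Vertex → Vertex
    glideᵛ k = ⟦ glide k ⟧

    reflect^ swap^ : Bool → Vertex → Vertex
    reflect^ e = fun (reflectᵃ ^ e)
    swap^ s = fun (swapᵃ ^ s)

    glideᵛ-glideᵛ : ∀ k l v → glideᵛ k (glideᵛ l v) ≡ glideᵛ (k +ᶻ l) v
    glideᵛ-glideᵛ k l v =
      trans (⟦⟧-∘ (glide k) (glide l) (glide-congruent k) v) (⟦⟧-cong _ _ (glide-glide k l) v)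

    glideᵛ-zero : ∀ v → glideᵛ 0ℤ v ≡ v
    glideᵛ-zero = ⟦⟧-identity (glide 0ℤ) glide-zero

    conjugate : Bool → ℤ → ℤ
    conjugate false k = k
    conjugate true k = u *ᶻ k

    mirror : Bool → ℤ → ℤ
    mirror false k = k
    mirror true k = -ᶻ k

    correction : Bool → Bool → ℤ
    correction false _ = 0ℤ
    correction true false = 0ℤ
    correction true true = w

    swap^-glideᵛ : ∀ s k v → swap^ s (glideᵛ k v) ≡ glideᵛ (conjugate s k) (swap^ s v)
    swap^-glideᵛ false k v = refl
    swap^-glideᵛ true k v =
      ⟦⟧-commute swap (glide k) (glide (u *ᶻ k)) swap swap-congruent (glide-congruent _) (swap-glide k) v

    swap^-reflect^ : ∀ s e v → swap^ s (reflect^ e v) ≡ glideᵛ (correction s e) (reflect^ e (swap^ s v))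
    swap^-reflect^ false e v = sym (glideᵛ-zero _)
    swap^-reflect^ true false v = sym (glideᵛ-zero _)
    swap^-reflect^ true true v = trans
      (⟦⟧-commute swap reflect (glide w) (reflect ∘ swap) swap-congruent (glide-congruent w) swap-reflect v)
      (cong (glideᵛ w) (sym (⟦⟧-∘ reflect swap reflect-congruent v)))

    reflect^-glideᵛ : ∀ e k v → reflect^ e (glideᵛ k v) ≡ glideᵛ (mirror e k) (reflect^ e v)
    reflect^-glideᵛ false k v = refl
    reflect^-glideᵛ true k v =
      ⟦⟧-commute reflect (glide k) (glide (-ᶻ k)) reflect reflect-congruent (glide-congruent _) (reflect-glide k) v

    Word : Set
    Word = Bool × Bool × ℤ

    element : Word → Aut
    element (s , e , k) = glideᵃ k ∘ᵃ reflectᵃ ^ e ∘ᵃ swapᵃ ^ s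

    act : Word → Vertex → Vertex
    act p = fun (element p)

    infixl 7 _·_
    _·_ : Word → Word → Word
    (s , e , k) · (s′ , e′ , k′) = s xor s′ , e xor e′ , k +ᶻ mirror e (conjugate s k′ +ᶻ correction s e′)

    act-· : ∀ p q v → act (p · q) v ≡ act p (act q v)
    act-· (s , e , k) (s′ , e′ , k′) v = sym (begin
      glideᵛ k (reflect^ e (swap^ s (glideᵛ k′ (reflect^ e′ (swap^ s′ v)))))
        ≡⟨ cong (glideᵛ k ∘ reflect^ e) (swap^-glideᵛ s k′ _) ⟩
      glideᵛ k (reflect^ e (glideᵛ (conjugate s k′) (swap^ s (reflect^ e′ (swap^ s′ v)))))
        ≡⟨ cong (glideᵛ k ∘ reflect^ e ∘ glideᵛ (conjugate s k′)) (swap^-reflect^ s e′ _) ⟩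
      glideᵛ k (reflect^ e (glideᵛ (conjugate s k′) (glideᵛ K′ (reflect^ e′ (swap^ s (swap^ s′ v))))))
        ≡⟨ cong (glideᵛ k ∘ reflect^ e) (glideᵛ-glideᵛ (conjugate s k′) K′ (reflect^ e′ (swap^ s (swap^ s′ v)))) ⟩
      glideᵛ k (reflect^ e (glideᵛ K (reflect^ e′ (swap^ s (swap^ s′ v)))))
        ≡⟨ cong (glideᵛ k ∘ reflect^ e ∘ glideᵛ K ∘ reflect^ e′) (^-xor swapᵃ (inv-left swapᵃ) s s′ v) ⟩
      glideᵛ k (reflect^ e (glideᵛ K (reflect^ e′ (swap^ (s xor s′) v))))
        ≡⟨ cong (glideᵛ k) (reflect^-glideᵛ e K _) ⟩
      glideᵛ k (glideᵛ (mirror e K) (reflect^ e (reflect^ e′ (swap^ (s xor s′) v))))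
        ≡⟨ glideᵛ-glideᵛ k (mirror e K) (reflect^ e (reflect^ e′ (swap^ (s xor s′) v))) ⟩
      glideᵛ (k +ᶻ mirror e K) (reflect^ e (reflect^ e′ (swap^ (s xor s′) v)))
        ≡⟨ cong (glideᵛ (k +ᶻ mirror e K)) (^-xor reflectᵃ (inv-left reflectᵃ) e e′ (swap^ (s xor s′) v)) ⟩
      glideᵛ (k +ᶻ mirror e K) (reflect^ (e xor e′) (swap^ (s xor s′) v))
        ∎)
      where
      open ≡-Reasoning
      K′ K : ℤ
      K′ = correction s e′
      K = conjugate s k′ +ᶻ K′

    inverse : Word → Word
    inverse (s , e , k) = s , e , -ᶻ mirror e (conjugate s k +ᶻ correction s e)

    act-inverse : ∀ p v → act (inverse p) (act p v) ≡ v
    act-inverse p@(s , e , k) v = begin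
      act (inverse p) (act p v)    ≡⟨ act-· (inverse p) p v ⟨
      act (inverse p · p) v        ≡⟨ cong (λ q → act q v) inverse-·-p ⟩
      act (false , false , 0ℤ) v   ≡⟨ glideᵛ-zero v ⟩
      v                            ∎
      where
      open ≡-Reasoning
      inverse-·-p : inverse p · p ≡ (false , false , 0ℤ)
      inverse-·-p = cong₂ _,_ (xor-same s)
        (cong₂ _,_ (xor-same e) (ℤ.+-inverseˡ (mirror e (conjugate s k +ᶻ correction s e))))

    base : Vertex
    base = false , reduce 0ℤ

    glide-trivial : ∀ k → + 2 *ᶻ k ≈ 0ℤ → ∀ p → glide k p ∼ p
    glide-trivial k 2k≈0 (false , y) = same-sheet (begin
      y +ᶻ + 2 *ᶻ k            ≈⟨ +-congˡ y 2k≈0 ⟩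
      y +ᶻ 0ℤ                  ≡⟨ ℤ.+-identityʳ y ⟩
      y                        ∎)
      where open ≈-Reasoning
    glide-trivial k 2k≈0 (true , y) = same-sheet (begin
      y +ᶻ (+ 2 +ᶻ + 4 *ᶻ 𝐃) *ᶻ k          ≡⟨ lemma y k 𝐃 ⟩
      y +ᶻ (1ℤ +ᶻ + 2 *ᶻ 𝐃) *ᶻ (+ 2 *ᶻ k)  ≈⟨ +-congˡ y (*-congˡ (1ℤ +ᶻ + 2 *ᶻ 𝐃) 2k≈0) ⟩
      y +ᶻ (1ℤ +ᶻ + 2 *ᶻ 𝐃) *ᶻ 0ℤ          ≡⟨ cong (y +ᶻ_) (ℤ.*-zeroʳ (1ℤ +ᶻ + 2 *ᶻ 𝐃)) ⟩
      y +ᶻ 0ℤ                              ≡⟨ ℤ.+-identityʳ y ⟩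
      y                                    ∎)
      where
      open ≈-Reasoning
      lemma : ∀ y k D → y +ᶻ (+ 2 +ᶻ + 4 *ᶻ D) *ᶻ k ≡ y +ᶻ (1ℤ +ᶻ + 2 *ᶻ D) *ᶻ (+ 2 *ᶻ k)
      lemma = solve-∀

    act-fixing-base : ∀ p → act p base ≡ base → ∀ v → act p v ≡ v
    act-fixing-base (true , e , k) eq = contradiction (trans (sym (sheet e)) (cong proj₁ eq)) λ ()
      where
      sheet : ∀ e → proj₁ (act (true , e , k) base) ≡ true
      sheet false = refl
      sheet true = refl
    act-fixing-base (false , true , k) eq = contradiction (∼⇒≈ fixed) (reflected-glide-moves-everything _ k)
      where
      fixed : glide k (reflect (liftᵛ base)) ∼ liftᵛ base
      fixed = ⟦⟧-fixed (glide k ∘ reflect) base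
                (trans (sym (⟦⟧-∘ (glide k) reflect (glide-congruent k) base)) eq)
    act-fixing-base (false , false , k) eq = ⟦⟧-identity (glide k) (glide-trivial k 2k≈0)
      where
      open ≈-Reasoning
      x : ℤ
      x = lift (reduce 0ℤ)
      2k≈0 : + 2 *ᶻ k ≈ 0ℤ
      2k≈0 = begin
        + 2 *ᶻ k                 ≡⟨ lemma x (+ 2 *ᶻ k) ⟩
        x +ᶻ + 2 *ᶻ k -ᶻ x       ≈⟨ +-congʳ (-ᶻ x) (∼⇒≈ (⟦⟧-fixed (glide k) base eq)) ⟩
        x -ᶻ x                   ≡⟨ ℤ.+-inverseʳ x ⟩
        0ℤ                       ∎
        where
        lemma : ∀ x y → y ≡ x +ᶻ y -ᶻ x
        lemma = solve-∀

    reach-rim : ∀ j → ∃[ p ] act p base ≡ (false , j)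
    reach-rim j = from-parity (parity (lift j))
      where
      open ≈-Reasoning
      x₀≈0 : lift (reduce 0ℤ) ≈ 0ℤ
      x₀≈0 = lift-reduce 0ℤ
      from-parity : ∃[ m ] (lift j ≡ m *ᶻ + 2 ⊎ lift j ≡ 1ℤ +ᶻ m *ᶻ + 2)
                  → ∃[ p ] act p base ≡ (false , j)
      from-parity (m , inj₁ j≡2m) = (false , false , m) , cong (false ,_) (trans (reduce-cong (begin
        lift (reduce 0ℤ) +ᶻ + 2 *ᶻ m     ≈⟨ +-congʳ (+ 2 *ᶻ m) x₀≈0 ⟩
        0ℤ +ᶻ + 2 *ᶻ m                   ≡⟨ lemma m ⟩
        m *ᶻ + 2                         ≡⟨ j≡2m ⟨
        lift j                           ∎)) (reduce-lift j))
        where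
        lemma : ∀ m → 0ℤ +ᶻ + 2 *ᶻ m ≡ m *ᶻ + 2
        lemma = solve-∀
      from-parity (m , inj₂ j≡1+2m) = (false , true , m) , trans (⟦⟧-∘ (glide m) reflect (glide-congruent m) base)
        (cong (false ,_) (trans (reduce-cong (begin
          1ℤ -ᶻ lift (reduce 0ℤ) +ᶻ + 2 *ᶻ m   ≈⟨ +-congʳ (+ 2 *ᶻ m) (+-congˡ 1ℤ (-‿cong x₀≈0)) ⟩
          1ℤ -ᶻ 0ℤ +ᶻ + 2 *ᶻ m                 ≡⟨ lemma m ⟩
          1ℤ +ᶻ m *ᶻ + 2                       ≡⟨ j≡1+2m ⟨
          lift j                               ∎)) (reduce-lift j)))
        where
        lemma : ∀ m → 1ℤ -ᶻ 0ℤ +ᶻ + 2 *ᶻ m ≡ 1ℤ +ᶻ m *ᶻ + 2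
        lemma = solve-∀

    reach : ∀ v → ∃[ p ] act p base ≡ v
    reach (false , j) = reach-rim j
    reach (true , j) = swap-word · p , (begin
      act (swap-word · p) base                  ≡⟨ act-· swap-word p base ⟩
      act swap-word (act p base)                ≡⟨ cong (act swap-word) p-reaches ⟩
      act swap-word (false , reduce (c′ *ᶻ J))   ≡⟨ glideᵛ-zero _ ⟩
      true , reduce (c *ᶻ lift (reduce (c′ *ᶻ J)))
        ≡⟨ cong (true ,_) (trans (reduce-cong swap-back) (reduce-lift j)) ⟩
      true , j                                  ∎)
      where
      open ≡-Reasoning
      J : ℤ
      J = lift j
      swap-word p : Word
      swap-word = true , false , 0ℤ
      p = proj₁ (reach-rim (reduce (c′ *ᶻ J)))
      p-reaches : act p base ≡ (false , reduce (c′ *ᶻ J))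
      p-reaches = proj₂ (reach-rim (reduce (c′ *ᶻ J)))
      swap-back : c *ᶻ lift (reduce (c′ *ᶻ J)) ≈ J
      swap-back = ≈-trans (*-congˡ c (lift-reduce (c′ *ᶻ J))) (∼⇒≈ (swap-involutive (true , J)))

    cayley : IsCayley Vertex (RWAdj (8 ℕ.* D) (4 ℕ.* D) r)
    cayley = regular-family⇒IsCayley Word element base
      (λ p q → p · q , act-· p q) (λ p → inverse p , act-inverse p) reach act-fixing-base

odd-mod-4 : ∀ r → ¬ (2 ∣ r) → ∃[ w ] (r ≡ 1 + 4 * w ⊎ r ≡ 3 + 4 * w)
odd-mod-4 r r-odd with r ℕ.% 4 | ℕ.m%n<n r 4 | ℕ.m≡m%n+[m/n]*n r 4
... | 0 | _ | r≡ = contradiction (divides (r ℕ./ 4 * 2) (trans r≡ (lemma (r ℕ./ 4)))) r-odd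
  where
  lemma : ∀ w → 0 + w * 4 ≡ w * 2 * 2
  lemma = ℕ-Solver.solve-∀
... | 1 | _ | r≡ = r ℕ./ 4 , inj₁ (trans r≡ (cong (λ m → 1 + m) (ℕ.*-comm (r ℕ./ 4) 4)))
... | 2 | _ | r≡ = contradiction (divides (1 + r ℕ./ 4 * 2) (trans r≡ (lemma (r ℕ./ 4)))) r-odd
  where
  lemma : ∀ w → 2 + w * 4 ≡ (1 + w * 2) * 2
  lemma = ℕ-Solver.solve-∀
... | 3 | _ | r≡ = r ℕ./ 4 , inj₂ (trans r≡ (cong (λ m → 3 + m) (ℕ.*-comm (r ℕ./ 4) 4)))
... | ℕ.suc (ℕ.suc (ℕ.suc (ℕ.suc _))) | s≤s (s≤s (s≤s (s≤s ()))) | _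

odd-square : ∀ r → ¬ (2 ∣ r) → ∃[ X ] r * r ≡ 1 + 8 * X
odd-square r r-odd with odd-mod-4 r r-odd
... | w , inj₁ refl = w + 2 * (w * w) , lemma w
  where
  lemma : ∀ w → (1 + 4 * w) * (1 + 4 * w) ≡ 1 + 8 * (w + 2 * (w * w))
  lemma = ℕ-Solver.solve-∀
... | w , inj₂ refl = 1 + 3 * w + 2 * (w * w) , lemma w
  where
  lemma : ∀ w → (3 + 4 * w) * (3 + 4 * w) ≡ 1 + 8 * (1 + 3 * w + 2 * (w * w))
  lemma = ℕ-Solver.solve-∀

three-mod-4-representative : ∀ r → ¬ (2 ∣ r)
                           → ∃[ t ] (+ 3 +ᶻ + 4 *ᶻ t ≡ + r ⊎ + 3 +ᶻ + 4 *ᶻ t ≡ -ᶻ + r)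
three-mod-4-representative r r-odd with odd-mod-4 r r-odd
... | w , inj₁ refl = -ᶻ (1ℤ +ᶻ + w) , inj₂ (trans (lemma (+ w)) (cong -ᶻ_ (sym (pos-1+4w w))))
  where
  lemma : ∀ w → + 3 +ᶻ + 4 *ᶻ (-ᶻ (1ℤ +ᶻ w)) ≡ -ᶻ (1ℤ +ᶻ + 4 *ᶻ w)
  lemma = solve-∀
  pos-1+4w : ∀ w → + (1 + 4 * w) ≡ 1ℤ +ᶻ + 4 *ᶻ + w
  pos-1+4w w = trans (ℤ.pos-+ 1 (4 * w)) (cong (1ℤ +ᶻ_) (ℤ.pos-* 4 w))
... | w , inj₂ refl = + w , inj₁ (sym (trans (ℤ.pos-+ 3 (4 * w)) (cong (+ 3 +ᶻ_) (ℤ.pos-* 4 w))))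

square-of-± : ∀ {c x} → c ≡ x ⊎ c ≡ -ᶻ x → c *ᶻ c ≡ x *ᶻ x
square-of-± (inj₁ refl) = refl
square-of-± {x = x} (inj₂ refl) = lemma x
  where
  lemma : ∀ x → -ᶻ x *ᶻ -ᶻ x ≡ x *ᶻ x
  lemma = solve-∀

cayley-8D : ∀ D .{{_ : NonZero D}} r q → ¬ (2 ∣ r) → r * r + 4 * D ≡ 1 + q * (8 * D)
          → IsCayley (RWVertex (8 * D)) (RWAdj (8 * D) (4 * D) r)
cayley-8D D r q r-odd r²+a≡1+qn = construct (three-mod-4-representative r r-odd)
  where
  construct : ∃[ t ] (+ 3 +ᶻ + 4 *ᶻ t ≡ + r ⊎ + 3 +ᶻ + 4 *ᶻ t ≡ -ᶻ + r)
            → IsCayley (RWVertex (8 * D)) (RWAdj (8 * D) (4 * D) r)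
  construct (t , c≡±r) = RegularSubgroup.cayley D r t
    (⊎-map ≈-reflexive ≈-reflexive c≡±r) (differ-by (+ q) c²+a≡1+qn)
    where
    open RegularSubgroup D r t using (c; ≈-reflexive; differ-by; 𝐃; 8D≢0)
    c²+a≡1+qn : c *ᶻ c +ᶻ + 4 *ᶻ 𝐃 ≡ 1ℤ +ᶻ + q *ᶻ + (8 * D)
    c²+a≡1+qn = begin
      c *ᶻ c +ᶻ + 4 *ᶻ 𝐃           ≡⟨ cong₂ _+ᶻ_ (square-of-± c≡±r) (sym (ℤ.pos-* 4 D)) ⟩
      + r *ᶻ + r +ᶻ + (4 * D)      ≡⟨ cong (_+ᶻ + (4 * D)) (ℤ.pos-* r r) ⟨
      + (r * r) +ᶻ + (4 * D)       ≡⟨ ℤ.pos-+ (r * r) (4 * D) ⟨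
      + (r * r + 4 * D)            ≡⟨ cong +_ r²+a≡1+qn ⟩
      + (1 + q * (8 * D))          ≡⟨ ℤ.pos-+ 1 (q * (8 * D)) ⟩
      1ℤ +ᶻ + (q * (8 * D))        ≡⟨ cong (1ℤ +ᶻ_) (ℤ.pos-* q (8 * D)) ⟩
      1ℤ +ᶻ + q *ᶻ + (8 * D)       ∎
      where open ≡-Reasoning

n≡8D×a≡4D : ∀ n a r q → 4 ∣ n → 2 * a ≡ n → ¬ (2 ∣ r) → r * r + a ≡ 1 + q * n
       → ∃[ D ] (n ≡ 8 * D × a ≡ 4 * D)
n≡8D×a≡4D n a r q (divides m n≡m*4) 2a≡n r-odd r²+a≡1+qn = quotient 2∣m , n≡8D , a≡4D
  where
  X : ℕ
  X = proj₁ (odd-square r r-odd)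
  a≡m*2 : a ≡ m * 2
  a≡m*2 = ℕ.*-cancelˡ-≡ a (m * 2) 2 (trans 2a≡n (trans n≡m*4 (lemma m)))
    where
    lemma : ∀ m → m * 4 ≡ 2 * (m * 2)
    lemma = ℕ-Solver.solve-∀
  1+8X+2m≡1+4qm : 1 + 8 * X + m * 2 ≡ 1 + q * (m * 4)
  1+8X+2m≡1+4qm = trans (cong₂ _+_ (sym (proj₂ (odd-square r r-odd))) (sym a≡m*2))
                        (trans r²+a≡1+qn (cong (λ k → 1 + q * k) n≡m*4))
  4X+m≡2qm : 4 * X + m ≡ q * m * 2
  4X+m≡2qm = ℕ.*-cancelˡ-≡ _ _ 2 (trans (lemma₁ X m) (trans (ℕ.suc-injective 1+8X+2m≡1+4qm) (lemma₂ q m)))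
    where
    lemma₁ : ∀ X m → 2 * (4 * X + m) ≡ 8 * X + m * 2
    lemma₁ = ℕ-Solver.solve-∀
    lemma₂ : ∀ q m → q * (m * 4) ≡ 2 * (q * m * 2)
    lemma₂ = ℕ-Solver.solve-∀
  2∣m : 2 ∣ m
  2∣m = ∣m+n∣m⇒∣n (divides (q * m) 4X+m≡2qm) (divides (2 * X) (lemma X))
    where
    lemma : ∀ X → 4 * X ≡ 2 * X * 2
    lemma = ℕ-Solver.solve-∀
  n≡8D : n ≡ 8 * quotient 2∣m
  n≡8D = trans n≡m*4 (trans (cong (_* 4) (equality 2∣m)) (lemma (quotient 2∣m)))
    where
    lemma : ∀ D → D * 2 * 4 ≡ 8 * D
    lemma = ℕ-Solver.solve-∀
  a≡4D : a ≡ 4 * quotient 2∣m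
  a≡4D = trans a≡m*2 (trans (cong (_* 2) (equality 2∣m)) (lemma (quotient 2∣m)))
    where
    lemma : ∀ D → D * 2 * 2 ≡ 4 * D
    lemma = ℕ-Solver.solve-∀

mainTheorem6 : (n a r : ℕ) → 4 ≤ n → 4 ∣ n → 2 * a ≡ n → 1 ≤ r → r < n → ¬ (2 ∣ r)
    → (∃[ q ] (r * r + a ≡ 1 + q * n))
    → IsCayley (RWVertex n) (RWAdj n a r)
mainTheorem6 n a r 4≤n 4∣n 2a≡n _ _ r-odd (q , r²+a≡1+qn) =
  subst₂ (λ n a → IsCayley (RWVertex n) (RWAdj n a r)) (sym n≡8D) (sym a≡4D)
    (cayley-8D D {{D≢0}} r q r-odd (subst₂ (λ n a → r * r + a ≡ 1 + q * n) n≡8D a≡4D r²+a≡1+qn))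
  where
  D : ℕ
  D = proj₁ (n≡8D×a≡4D n a r q 4∣n 2a≡n r-odd r²+a≡1+qn)
  n≡8D : n ≡ 8 * D
  n≡8D = proj₁ (proj₂ (n≡8D×a≡4D n a r q 4∣n 2a≡n r-odd r²+a≡1+qn))
  a≡4D : a ≡ 4 * D
  a≡4D = proj₂ (proj₂ (n≡8D×a≡4D n a r q 4∣n 2a≡n r-odd r²+a≡1+qn))
  D≢0 : NonZero D
  D≢0 = ℕ.≢-nonZero λ D≡0 → contradiction (subst (4 ≤_) (trans n≡8D (cong (8 *_) D≡0)) 4≤n) λ ()
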